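{- Let $p$ be a prime and $k=p-1$. The permutation $\sigma$ of $[k]$ given by $\sigma(k)=1$ and $\sigma(i)=i+1$ for $1\le i<k$ (i.e. the sequence $(2,3,\dots,k,1)$) is weakly consecutive.
   Context: $[k]=\{1,\dots,k\}$. A permutation $\sigma:[k]\to[k]$ is weakly consecutive if for all $i,j\in[k]$ and all integers $m$, whenever $m\mid\sigma(i)$ and $m\mid(i-j)$, also $m\mid\sigma(j)$. -}

module Defs where

open import Data.Nat using (ℕ; suc; _≤_; _<_; _≟_)
open import Data.Integer using (ℤ; +_; _-_)
open import Data.Integer.Divisibility using (_∣_)
open import Data.Product using (_×_)
open import Relation.Binary.PropositionalEquality using (_≡_)
open import Relation.Nullary using (yes; no)

-- Maps on [k] = {1,…,k} are represented as functions ℕ → ℕ; only their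
-- values on 1 ≤ i ≤ k matter.

InRange : ℕ → ℕ → Set
InRange k i = 1 ≤ i × i ≤ k

-- σ is a permutation of [k]: maps [k] into [k] and is injective on [k]
-- (hence bijective, [k] being finite).
IsPermutation : ℕ → (ℕ → ℕ) → Set
IsPermutation k σ =
  (∀ i → InRange k i → InRange k (σ i)) ×
  (∀ i j → InRange k i → InRange k j → σ i ≡ σ j → i ≡ j)

WeaklyConsecutive : ℕ → (ℕ → ℕ) → Set
WeaklyConsecutive k σ =
  ∀ i j → InRange k i → InRange k j → (m : ℤ) →
  m ∣ (+ σ i) → m ∣ ((+ i) - (+ j)) → m ∣ (+ σ j)

shift : ℕ → ℕ → ℕ
shift k i with i ≟ k
... | yes _ = 1
... | no _ = suc i

-- If i ≠ k then σ(i) = i + 1, and m ∣ i + 1, m ∣ i − j give m ∣ j + 1; this is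
-- σ(j) unless j = k, where j + 1 = p.  Then |m| divides both the prime p and the
-- number i + 1 < p, so |m| = 1.  If i = k then m ∣ σ(k) = 1 and |m| = 1 outright.
module Submission where

open import Defs
open import Data.Nat using (ℕ; _∸_)
open import Data.Nat.Primality using (Prime)
open import Data.Product using (_×_)

open import Data.Nat using (zero; suc; _≟_; s≤s; z≤n)
open import Data.Nat.Properties using (≤-trans; ≤∧≢⇒<; suc-injective)
open import Data.Nat.Divisibility using (1∣_; ∣1⇒≡1)
open import Data.Nat.Coprimality using (prime⇒coprime)
open import Data.Nat.Primality using (¬prime[0])
open import Data.Integer using (ℤ; +_; _-_; ∣_∣; 1ℤ)
  renaming (_+_ to _+ℤ_)
open import Data.Integer.Divisibility using (_∣_)
open import Data.Integer.Divisibility.Signed as Signed using (∣ᵤ⇒∣; ∣⇒∣ᵤ; ∣m∣n⇒∣m-n)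
open import Data.Integer.Tactic.RingSolver using (solve-∀)
open import Data.Product using (_,_)
open import Data.Empty using (⊥-elim)
open import Relation.Binary.PropositionalEquality using (_≡_; refl; sym; trans; subst)
open import Relation.Nullary using (yes; no)

∣ᵤ-unit : ∀ {m : ℤ} → ∣ m ∣ ≡ 1 → ∀ n → m ∣ n
∣ᵤ-unit ∣m∣≡1 n rewrite ∣m∣≡1 = 1∣ ∣ n ∣

∣1⇒∣ : ∀ {m : ℤ} → m ∣ + 1 → ∀ n → m ∣ n
∣1⇒∣ {m} m∣1 = ∣ᵤ-unit {m} (∣1⇒≡1 m∣1)

∣1+i∧∣i-j⇒∣1+j : ∀ {m : ℤ} {i j : ℕ} → m ∣ + suc i → m ∣ (+ i - + j) → m ∣ + suc j
∣1+i∧∣i-j⇒∣1+j {m} {i} {j} m∣1+i m∣i-j =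
  ∣⇒∣ᵤ (subst (Signed._∣_ m) (sym (1+b≡1+a-[a-b] (+ i) (+ j)))
    (∣m∣n⇒∣m-n {m} {+ suc i} {+ i - + j} (∣ᵤ⇒∣ {m} m∣1+i) (∣ᵤ⇒∣ {m} m∣i-j)))
  where
  1+b≡1+a-[a-b] : ∀ (a b : ℤ) → 1ℤ +ℤ b ≡ (1ℤ +ℤ a) - (a - b)
  1+b≡1+a-[a-b] = solve-∀

shift-isPermutation : ∀ k → IsPermutation k (shift k)
shift-isPermutation k = shift-inRange , shift-injective
  where
  shift-inRange : ∀ i → InRange k i → InRange k (shift k i)
  shift-inRange i (1≤i , i≤k) with i ≟ k
  ... | yes _   = s≤s z≤n , ≤-trans 1≤i i≤k
  ... | no  i≢k = s≤s z≤n , ≤∧≢⇒< i≤k i≢k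

  shift-injective : ∀ i j → InRange k i → InRange k j → shift k i ≡ shift k j → i ≡ j
  shift-injective i j i∈[k] j∈[k] σi≡σj with i ≟ k | j ≟ k
  shift-injective i j _        _        _     | yes i≡k | yes j≡k = trans i≡k (sym j≡k)
  shift-injective i j _        (() , _) refl  | yes _   | no  _
  shift-injective i j (() , _) _        refl  | no  _   | yes _
  shift-injective i j _        _        σi≡σj | no  _   | no  _   = suc-injective σi≡σj

shift-weaklyConsecutive : ∀ {k} → Prime (suc k) → WeaklyConsecutive k (shift k)
shift-weaklyConsecutive {k} p i j (_ , i≤k) _ m m∣σi m∣i-j with i ≟ k
... | yes refl = ∣1⇒∣ {m} m∣σi (+ shift k j)
... | no  i≢k with j ≟ k
...   | no  _    = ∣1+i∧∣i-j⇒∣1+j {m} m∣σi m∣i-j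
...   | yes refl = ∣ᵤ-unit {m} ∣m∣≡1 (+ 1)
  where
  ∣m∣≡1 : ∣ m ∣ ≡ 1
  ∣m∣≡1 = prime⇒coprime p (s≤s (≤∧≢⇒< i≤k i≢k)) (∣1+i∧∣i-j⇒∣1+j {m} m∣σi m∣i-j , m∣σi)

mainTheorem7 : (p : ℕ) → Prime p →
    IsPermutation (p ∸ 1) (shift (p ∸ 1)) × WeaklyConsecutive (p ∸ 1) (shift (p ∸ 1))
mainTheorem7 zero    p-prime = ⊥-elim (¬prime[0] p-prime)
mainTheorem7 (suc k) p-prime = shift-isPermutation k , shift-weaklyConsecutive p-prime
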